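{- Let $S$ be a graph such that: $S$ is connected; every vertex of $S$ has degree at most 3; every vertex of $S$ of degree 2 or 3 belongs to exactly one triangle of $S$; and $S$ has at least three vertices of degree 1. Then $S$ has no $\Lambda$-factor.
   Context: Graphs are finite, simple, undirected. A $\Lambda$-factor of a graph $H$ is a spanning subgraph of $H$ each of whose components is a 3-vertex path. -}

module Defs where

open import Data.Nat using (ℕ; zero; suc; _≤_; _<_)
open import Data.Fin using (Fin) renaming (_<_ to _<ᶠ_)
open import Data.Bool using (Bool; true; false; _∧_)
open import Data.List using (List; []; _∷_; filter; length; allFin; concatMap; _++_)
open import Data.List.Relation.Unary.All using (All)
open import Data.Product using (Σ; _×_; _,_; ∃)
open import Relation.Binary.PropositionalEquality using (_≡_; _≢_)
open import Relation.Nullary using (¬_)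
open import Relation.Nullary.Decidable using (⌊_⌋)
open import Data.Fin.Properties using (_<?_)

open import Data.List.Relation.Unary.Any using (Any)
open import Data.Fin using () renaming (_≟_ to _≟ᶠ_)
import Data.List.Membership.DecPropositional as DP

record Graph (n : ℕ) : Set where
  field
    adj   : Fin n → Fin n → Bool
    sym   : ∀ u v → adj u v ≡ adj v u
    irrefl : ∀ v → adj v v ≡ false
open Graph public

Adj : ∀ {n} → Graph n → Fin n → Fin n → Set
Adj G u v = adj G u v ≡ true

degree : ∀ {n} → Graph n → Fin n → ℕ
degree G v = length (filter (λ u → adj G v u Data.Bool.≟ true) (allFin _))
  where import Data.Bool

-- triangles of G containing v, each counted once as an unordered pair {u,w}
-- (with u < w) of adjacent neighbours of v
trianglesAt : ∀ {n} → Graph n → Fin n → List (Fin n × Fin n)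
trianglesAt {n} G v =
  filter (λ p → dec p) (concatMap (λ u → Data.List.map (u ,_) (allFin n)) (allFin n))
  where
  open import Relation.Nullary using (Dec; yes; no)
  import Data.List
  open import Data.Bool using (_≟_)
  dec : (p : Fin n × Fin n) → Dec _
  dec (u , w) = (adj G v u ∧ adj G v w ∧ adj G u w ∧ ⌊ u <? w ⌋) ≟ true

data Walk {n} (G : Graph n) : Fin n → Fin n → Set where
  here : ∀ {v} → Walk G v v
  step : ∀ {u v w} → Adj G u v → Walk G v w → Walk G u w

Connected : ∀ {n} → Graph n → Set
Connected G = ∀ u v → Walk G u v

record Path3 {n} (G : Graph n) : Set where
  constructor path3
  field
    a b c : Fin n
    ab : Adj G a b
    bc : Adj G b c
    ac : a ≢ c

vertices3 : ∀ {n} {G : Graph n} → Path3 G → List (Fin n)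
vertices3 (path3 a b c _ _ _) = a ∷ b ∷ c ∷ []

-- A Λ-factor: a spanning subgraph whose components are 3-vertex paths,
-- i.e. a family of 3-vertex paths of G such that every vertex lies on
-- exactly one of them (vertex-disjoint and covering).
record ΛFactor {n} (G : Graph n) : Set where
  field
    paths   : List (Path3 G)
    exactly : (v : Fin n) → length (filter (λ (P : Path3 G) → DP._∈?_ (_≟ᶠ_ {n}) v (vertices3 {n} {G} P)) paths) ≡ 1

module Submission where

-- A subcubic graph S in which every vertex of degree 2 or 3 lies on exactly
-- one triangle has no Λ-factor as soon as it has a single vertex of degree 1.
--
-- Fix a Λ-factor F.  Say d ⟶ g ("Link d g") when d is an end of its F-path
-- d-b-c and g is a vertex off that path adjacent to both b and c, so that
-- {g, b, c} is the triangle of g.  Three facts drive the proof: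
--   * the leaf ℓ has a successor, and no vertex has ℓ as a successor;
--   * every successor has a successor again (the degree bound forces the
--     centre b of the next path to close its triangle with the end c);
--   * d ⟶ g determines d, since g's unique triangle determines the path.
-- The resulting chain ℓ ⟶ g₀ ⟶ g₁ ⟶ ⋯ is then injective, which is
-- impossible in a finite vertex set (`noChainFromSource`).

open import Defs
open import Level using (0ℓ)
open import Data.Nat using (ℕ; zero; suc; _≤_; _<_; z≤n; s≤s; _≟_)
import Data.Nat.Properties as ℕP
open import Data.Fin using (Fin) renaming (_<_ to _<ᶠ_)
import Data.Fin.Properties as FinP
open import Data.Bool using (true; _∧_)
import Data.Bool as Bool
open import Data.List using (List; []; _∷_; length; filter; allFin; concatMap; map; lookup)
open import Data.List.Membership.Propositional using (_∈_; _∉_)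
open import Data.List.Membership.Propositional.Properties
  using (∈-filter⁺; ∈-filter⁻; ∈-allFin; ∈-concatMap⁺; ∈-map⁺)
open import Data.List.Relation.Unary.Any using (here; there; index)
import Data.List.Relation.Unary.Any as Any
open import Data.List.Relation.Unary.Any.Properties using (lookup-index)
open import Data.Vec using (Vec; []; _∷_) renaming (lookup to lookupᵥ)
open import Data.Vec.Relation.Unary.All using ([]; _∷_) renaming (All to Allᵥ)
open import Data.Vec.Relation.Unary.All.Properties using (lookup⁺)
open import Data.Vec.Relation.Unary.Unique.Propositional using (Unique; []; _∷_)
open import Data.Vec.Relation.Unary.Unique.Propositional.Properties using (lookup-injective)
open import Data.Product using (Σ; ∃; _×_; _,_; proj₁; proj₂)
open import Data.Sum using (_⊎_; inj₁; inj₂; swap)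
open import Data.Empty using (⊥; ⊥-elim)
open import Relation.Binary.PropositionalEquality
  using (_≡_; _≢_; refl; trans; subst; cong) renaming (sym to ≡-sym)
open import Relation.Binary.Definitions using (tri<; tri≈; tri>)
open import Relation.Nullary using (¬_; yes; no)
open import Relation.Nullary.Decidable using (⌊_⌋)
open import Relation.Unary using (Pred; Decidable)
open import Function using (_∘′_)

∈-singleton-unique : ∀ {A : Set} {x y : A} {ys : List A} →
                     length ys ≡ 1 → x ∈ ys → y ∈ ys → x ≡ y
∈-singleton-unique {ys = _ ∷ []} _ (here x≡z) (here y≡z) = trans x≡z (≡-sym y≡z)

nonempty-∈ : ∀ {A : Set} (ys : List A) → 0 < length ys → ∃ λ y → y ∈ ys
nonempty-∈ (y ∷ _) _ = y , here refl

module Counting {A : Set} {P : Pred A 0ℓ} (P? : Decidable P) where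

  count≡1⇒unique : ∀ xs {x y} → length (filter P? xs) ≡ 1 →
                   x ∈ xs → P x → y ∈ xs → P y → x ≡ y
  count≡1⇒unique xs one x∈ px y∈ py =
    ∈-singleton-unique one (∈-filter⁺ P? x∈ px) (∈-filter⁺ P? y∈ py)

  count>0⇒witness : ∀ xs → 0 < length (filter P? xs) → ∃ λ x → x ∈ xs × P x
  count>0⇒witness xs pos with nonempty-∈ (filter P? xs) pos
  ... | x , x∈ = x , ∈-filter⁻ P? x∈

open Counting

∧-true : ∀ {a b} → a ∧ b ≡ true → a ≡ true × b ≡ true
∧-true {true} {true} refl = refl , refl

≡1⇒pos : ∀ {k} → k ≡ 1 → 0 < k
≡1⇒pos refl = s≤s z≤n

-- Let R be a relation on a finite set in which every
-- element has at most one R-predecessor and every R-successor has an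
-- R-successor again.  Then no element without predecessor has a successor:
-- the chain it would start never repeats, so it cannot fit in Fin n.
noChainFromSource : ∀ {n} (R : Fin n → Fin n → Set) →
  (∀ {a b c} → R a c → R b c → a ≡ b) →
  (∀ {a b} → R a b → ∃ (R b)) →
  ∀ {s} → (∀ {a} → ¬ R a s) → ¬ ∃ (R s)
noChainFromSource {n} R predecessor-unique successor {s} source first =
  FinP.<⇒notInjective (ℕP.n<1+n n) (λ eq → FinP.toℕ-injective (chain-injective _ _ eq))
  where
  -- chain k = (x k , x (suc k) , proof of R (x k) (x (suc k)))
  chain : ℕ → Σ (Fin n) λ a → ∃ (R a)
  chain zero    = s , first
  chain (suc k) = proj₁ (proj₂ (chain k)) , successor (proj₂ (proj₂ (chain k)))

  x : ℕ → Fin n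
  x k = proj₁ (chain k)

  x-step : ∀ k → R (x k) (x (suc k))
  x-step k = proj₂ (proj₂ (chain k))

  chain-injective : ∀ i j → x i ≡ x j → i ≡ j
  chain-injective zero    zero    _   = refl
  chain-injective zero    (suc j) eq = ⊥-elim (source (subst (R (x j)) (≡-sym eq) (x-step j)))
  chain-injective (suc i) zero    eq = ⊥-elim (source (subst (R (x i)) eq (x-step i)))
  chain-injective (suc i) (suc j) eq =
    cong suc (chain-injective i j (predecessor-unique (x-step i) (subst (R (x j)) (≡-sym eq) (x-step j))))

module GraphFacts {n : ℕ} (S : Graph n) where

  adj-sym : ∀ {x y} → Adj S x y → Adj S y x
  adj-sym {x} {y} xy = trans (≡-sym (Graph.sym S x y)) xy

  adj⇒≢ : ∀ {x y} → Adj S x y → x ≢ y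
  adj⇒≢ {x} xy refl with trans (≡-sym xy) (Graph.irrefl S x)
  ... | ()

  neighbours : Fin n → List (Fin n)
  neighbours v = filter (λ u → adj S v u Bool.≟ true) (allFin n)

  ∈-neighbours : ∀ {v u} → Adj S v u → u ∈ neighbours v
  ∈-neighbours vu = ∈-filter⁺ _ (∈-allFin _) vu

  -- k pairwise distinct neighbours of v force degree v ≥ k: indexing them in
  -- the neighbour list is an injection Fin k → Fin (degree v).
  distinct-neighbours≤degree : ∀ {v k} (xs : Vec (Fin n) k) →
    Unique xs → Allᵥ (Adj S v) xs → k ≤ degree S v
  distinct-neighbours≤degree {v} xs uniq adjs =
    FinP.injective⇒≤ {f = position} position-injective
    where
    position : Fin _ → Fin (degree S v)
    position i = index (∈-neighbours (lookup⁺ adjs i))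

    lookup-position : ∀ i → lookupᵥ xs i ≡ lookup (neighbours v) (position i)
    lookup-position i = lookup-index (∈-neighbours (lookup⁺ adjs i))

    position-injective : ∀ {i j} → position i ≡ position j → i ≡ j
    position-injective {i} {j} eq = lookup-injective uniq i j
      (trans (lookup-position i)
        (trans (cong (lookup (neighbours v)) eq) (≡-sym (lookup-position j))))

  two-neighbours : ∀ {v a b} → Adj S v a → Adj S v b → a ≢ b → 2 ≤ degree S v
  two-neighbours va vb a≢b =
    distinct-neighbours≤degree (_ ∷ _ ∷ []) ((a≢b ∷ []) ∷ [] ∷ []) (va ∷ vb ∷ [])

module LocalStructure {n : ℕ} (S : Graph n)
  (max-degree : ∀ v → degree S v ≤ 3)
  (one-triangle : ∀ v → (degree S v ≡ 2) ⊎ (degree S v ≡ 3) → length (trianglesAt S v) ≡ 1)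
  where

  open GraphFacts S

  no-four-neighbours : ∀ {v a b c d} → Adj S v a → Adj S v b → Adj S v c → Adj S v d →
    a ≢ b → a ≢ c → a ≢ d → b ≢ c → b ≢ d → c ≢ d → ⊥
  no-four-neighbours {v} va vb vc vd ab ac ad bc bd cd with
    ℕP.≤-trans (distinct-neighbours≤degree (_ ∷ _ ∷ _ ∷ _ ∷ [])
                  ((ab ∷ ac ∷ ad ∷ []) ∷ (bc ∷ bd ∷ []) ∷ (cd ∷ []) ∷ [] ∷ [])
                  (va ∷ vb ∷ vc ∷ vd ∷ []))
               (max-degree v)
  ... | s≤s (s≤s (s≤s ()))

  fourth-neighbour : ∀ {v p q r c} → Adj S v p → Adj S v q → Adj S v r →
    p ≢ q → p ≢ r → q ≢ r → Adj S v c → (c ≡ p) ⊎ (c ≡ q) ⊎ (c ≡ r)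
  fourth-neighbour {c = c} vp vq vr pq pr qr vc with c FinP.≟ _ | c FinP.≟ _ | c FinP.≟ _
  ... | yes c≡p | _        | _        = inj₁ c≡p
  ... | no _    | yes c≡q  | _        = inj₂ (inj₁ c≡q)
  ... | no _    | no _     | yes c≡r  = inj₂ (inj₂ c≡r)
  ... | no c≢p  | no c≢q   | no c≢r   =
    ⊥-elim (no-four-neighbours vp vq vr vc pq pr (c≢p ∘′ ≡-sym) qr (c≢q ∘′ ≡-sym) (c≢r ∘′ ≡-sym))

  degree-2-or-3 : ∀ {v a b} → Adj S v a → Adj S v b → a ≢ b → (degree S v ≡ 2) ⊎ (degree S v ≡ 3)
  degree-2-or-3 {v} va vb a≢b = between (two-neighbours va vb a≢b) (max-degree v)
    where
    between : ∀ {k} → 2 ≤ k → k ≤ 3 → (k ≡ 2) ⊎ (k ≡ 3)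
    between {1} (s≤s ()) _
    between {2} _ _ = inj₁ refl
    between {3} _ _ = inj₂ refl
    between {suc (suc (suc (suc _)))} _ (s≤s (s≤s (s≤s ())))

  IsTriangle : Fin n → Fin n × Fin n → Set
  IsTriangle v (u , w) = (adj S v u ∧ adj S v w ∧ adj S u w ∧ ⌊ u FinP.<? w ⌋) ≡ true

  triangle-edges : ∀ {v x y} → IsTriangle v (x , y) → Adj S v x × Adj S v y × Adj S x y
  triangle-edges t with ∧-true t
  ... | vx , t′ with ∧-true t′
  ... | vy , t″ = vx , vy , proj₁ (∧-true t″)

  allPairs : List (Fin n × Fin n)
  allPairs = concatMap (λ u → map (u ,_) (allFin n)) (allFin n)

  ∈-allPairs : ∀ x y → (x , y) ∈ allPairs
  ∈-allPairs x y = ∈-concatMap⁺ (λ u → map (u ,_) (allFin n))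
    (Any.map (λ { refl → ∈-map⁺ (x ,_) (∈-allFin y) }) (∈-allFin x))

  listed : ∀ {v u w} → Adj S v u → Adj S v w → Adj S u w → u <ᶠ w → IsTriangle v (u , w)
  listed {u = u} {w} vu vw uw u<w rewrite vu | vw | uw with u FinP.<? w
  ... | yes _   = refl
  ... | no u≮w = ⊥-elim (u≮w u<w)

  Listed : Fin n → Fin n → Fin n → Set
  Listed v x y = ∃ λ p → IsTriangle v p × ((p ≡ (x , y)) ⊎ (p ≡ (y , x)))

  listed-triangle : ∀ {v x y} → Adj S v x → Adj S v y → Adj S x y → Listed v x y
  listed-triangle {v} {x} {y} vx vy xy with FinP.<-cmp x y
  ... | tri< x<y _ _ = (x , y) , listed vx vy xy x<y , inj₁ refl
  ... | tri≈ _ x≡y _ = ⊥-elim (adj⇒≢ xy x≡y)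
  ... | tri> _ _ y<x = (y , x) , listed vy vx (adj-sym xy) y<x , inj₂ refl

  triangle : ∀ {v a b} → Adj S v a → Adj S v b → a ≢ b →
    ∃ λ x → ∃ λ y → Adj S v x × Adj S v y × Adj S x y
  triangle va vb a≢b
    with count>0⇒witness _ allPairs (≡1⇒pos (one-triangle _ (degree-2-or-3 va vb a≢b)))
  ... | (x , y) , _ , t = x , y , triangle-edges t

  Endpoint : Fin n → Fin n × Fin n → Set
  Endpoint w (x , y) = w ≡ x ⊎ w ≡ y

  reorient : ∀ {w x y p} → (p ≡ (x , y)) ⊎ (p ≡ (y , x)) → Endpoint w p → Endpoint w (x , y)
  reorient (inj₁ refl) w∈p = w∈p
  reorient (inj₂ refl) w∈p = swap w∈p

  unorient : ∀ {w x y p} → (p ≡ (x , y)) ⊎ (p ≡ (y , x)) → Endpoint w (x , y) → Endpoint w p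
  unorient (inj₁ refl) w∈xy = w∈xy
  unorient (inj₂ refl) w∈xy = swap w∈xy

  -- The edge opposite v in its triangle is unique: every endpoint of the
  -- edge xy is an endpoint of the edge x′y′.
  triangle-unique : ∀ {v x y x′ y′ w} → Adj S v x → Adj S v y → Adj S x y →
    Adj S v x′ → Adj S v y′ → Adj S x′ y′ → w ≡ x ⊎ w ≡ y → w ≡ x′ ⊎ w ≡ y′
  triangle-unique {v} {w = w} vx vy xy vx′ vy′ x′y′ =
    compare (listed-triangle vx vy xy) (listed-triangle vx′ vy′ x′y′)
    where
    compare : ∀ {x y x′ y′} → Listed v x y → Listed v x′ y′ → w ≡ x ⊎ w ≡ y → w ≡ x′ ⊎ w ≡ y′
    compare (p , tp , p-orient) (q , tq , q-orient) w∈xy =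
      reorient q-orient (subst (Endpoint w) p≡q (unorient p-orient w∈xy))
      where
      p≡q : p ≡ q
      p≡q = count≡1⇒unique _ allPairs (one-triangle v (degree-2-or-3 vx vy (adj⇒≢ xy)))
              (∈-allPairs _ _) tp (∈-allPairs _ _) tq

module FactorStructure {n : ℕ} {S : Graph n} (F : ΛFactor S) where

  open GraphFacts S

  paths : List (Path3 S)
  paths = ΛFactor.paths F

  V : Path3 S → List (Fin n)
  V = vertices3

  path-of : ∀ v → ∃ λ P → P ∈ paths × v ∈ V P
  path-of v = count>0⇒witness _ paths (≡1⇒pos (ΛFactor.exactly F v))

  path-unique : ∀ {P Q v} → P ∈ paths → Q ∈ paths → v ∈ V P → v ∈ V Q → P ≡ Q
  path-unique {v = v} P∈ Q∈ v∈P v∈Q =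
    count≡1⇒unique _ paths (ΛFactor.exactly F v) P∈ v∈P Q∈ v∈Q

  record EndOf (v : Fin n) (P : Path3 S) : Set where
    field
      b c    : Fin n
      v-b    : Adj S v b
      b-c    : Adj S b c
      v≢c    : v ≢ c
      v∈     : v ∈ V P
      b∈     : b ∈ V P
      c∈     : c ∈ V P
      covers : ∀ {w} → w ∈ V P → w ≡ v ⊎ w ≡ b ⊎ w ≡ c

    edge⊆path : ∀ {w} → w ≡ b ⊎ w ≡ c → w ∈ V P
    edge⊆path (inj₁ refl) = b∈
    edge⊆path (inj₂ refl) = c∈

    off-edge : ¬ (v ≡ b ⊎ v ≡ c)
    off-edge (inj₁ v≡b) = adj⇒≢ v-b v≡b
    off-edge (inj₂ v≡c) = v≢c v≡c

  record CentreOf (v : Fin n) (P : Path3 S) : Set where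
    field
      a c : Fin n
      v-a : Adj S v a
      v-c : Adj S v c
      a≢c : a ≢ c
      a∈  : a ∈ V P
      c∈  : c ∈ V P

  ∈-triple : ∀ {w p q r : Fin n} → w ∈ p ∷ q ∷ r ∷ [] → w ≡ p ⊎ w ≡ q ⊎ w ≡ r
  ∈-triple (here w≡p)                = inj₁ w≡p
  ∈-triple (there (here w≡q))        = inj₂ (inj₁ w≡q)
  ∈-triple (there (there (here w≡r))) = inj₂ (inj₂ w≡r)

  ∈-triple-reversed : ∀ {w p q r : Fin n} → w ∈ p ∷ q ∷ r ∷ [] → w ≡ r ⊎ w ≡ q ⊎ w ≡ p
  ∈-triple-reversed (here w≡p)                = inj₂ (inj₂ w≡p)
  ∈-triple-reversed (there (here w≡q))        = inj₂ (inj₁ w≡q)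
  ∈-triple-reversed (there (there (here w≡r))) = inj₁ w≡r

  position : ∀ {v} (P : Path3 S) → v ∈ V P → EndOf v P ⊎ CentreOf v P
  position (path3 a b c ab bc a≢c) (here refl) = inj₁ record
    { b = b ; c = c ; v-b = ab ; b-c = bc ; v≢c = a≢c
    ; v∈ = here refl ; b∈ = there (here refl) ; c∈ = there (there (here refl))
    ; covers = ∈-triple }
  position (path3 a b c ab bc a≢c) (there (here refl)) = inj₂ record
    { a = a ; c = c ; v-a = adj-sym ab ; v-c = bc ; a≢c = a≢c
    ; a∈ = here refl ; c∈ = there (there (here refl)) }
  position (path3 a b c ab bc a≢c) (there (there (here refl))) = inj₁ record
    { b = b ; c = a ; v-b = adj-sym bc ; b-c = adj-sym ab ; v≢c = a≢c ∘′ ≡-sym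
    ; v∈ = there (there (here refl)) ; b∈ = there (here refl) ; c∈ = here refl
    ; covers = ∈-triple-reversed }

module Links {n : ℕ} (S : Graph n)
  (max-degree : ∀ v → degree S v ≤ 3)
  (one-triangle : ∀ v → (degree S v ≡ 2) ⊎ (degree S v ≡ 3) → length (trianglesAt S v) ≡ 1)
  (F : ΛFactor S)
  where

  open GraphFacts S
  open LocalStructure S max-degree one-triangle
  open FactorStructure F

  record Link (d g : Fin n) : Set where
    field
      path  : Path3 S
      path∈ : path ∈ paths
      end   : EndOf d path
    open EndOf end public
    field
      g-b   : Adj S g b
      g-c   : Adj S g c
      g∉    : g ∉ V path

  -- The link d ⟶ g determines d: the triangle at g fixes the edge bc, hence
  -- the path through it, and d is the vertex of that path off bc.
  link-injective : ∀ {d d′ g} → Link d g → Link d′ g → d ≡ d′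
  link-injective {d} {d′} l l′ = d′-is-d (covers l d′∈path)
    where
    open Link
    edge⊆edge′ : ∀ {w} → w ≡ b l ⊎ w ≡ c l → w ≡ b l′ ⊎ w ≡ c l′
    edge⊆edge′ = triangle-unique (g-b l) (g-c l) (b-c l) (g-b l′) (g-c l′) (b-c l′)
    same-path : path l ≡ path l′
    same-path = path-unique (path∈ l) (path∈ l′) (b∈ l) (edge⊆path l′ (edge⊆edge′ (inj₁ refl)))
    d′∈path : d′ ∈ V (path l)
    d′∈path = subst (λ P → d′ ∈ V P) (≡-sym same-path) (v∈ l′)
    d′-is-d : d′ ≡ d ⊎ d′ ≡ b l ⊎ d′ ≡ c l → d ≡ d′
    d′-is-d (inj₁ d′≡d)  = ≡-sym d′≡d
    d′-is-d (inj₂ d′∈bc) = ⊥-elim (off-edge l′ (edge⊆edge′ d′∈bc))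

  link-from-end : ∀ {d P} → P ∈ paths → (e : EndOf d P) →
    (∀ {z} → Adj S d z → Adj S (EndOf.b e) z → ⊥) → ∃ (Link d)
  link-from-end {d} {P} P∈ e no-common = closing (triangle (adj-sym v-b) b-c v≢c)
    where
    open EndOf e

    link-to : ∀ {g} → Adj S g b → Adj S g c → g ≢ d → g ≢ c → Link d g
    link-to {g} g-b g-c g≢d g≢c = record
      { path = P ; path∈ = P∈ ; end = e ; g-b = g-b ; g-c = g-c ; g∉ = excluded ∘′ covers }
      where
      excluded : ¬ (g ≡ d ⊎ g ≡ b ⊎ g ≡ c)
      excluded (inj₁ g≡d)        = g≢d g≡d
      excluded (inj₂ (inj₁ g≡b)) = adj⇒≢ g-b g≡b
      excluded (inj₂ (inj₂ g≡c)) = g≢c g≡c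

    -- b has the three distinct neighbours p, q, d, so its neighbour c is p
    -- or q, and the other one closes the triangle over bc.
    closing : (∃ λ p → ∃ λ q → Adj S b p × Adj S b q × Adj S p q) → ∃ (Link d)
    closing (p , q , b-p , b-q , p-q) =
      choose (fourth-neighbour b-p b-q (adj-sym v-b) (adj⇒≢ p-q) p≢d q≢d b-c)
      where
      p≢d : p ≢ d
      p≢d refl = no-common p-q b-q
      q≢d : q ≢ d
      q≢d refl = no-common (adj-sym p-q) b-p
      choose : c ≡ p ⊎ c ≡ q ⊎ c ≡ d → ∃ (Link d)
      choose (inj₁ c≡p) = q , link-to (adj-sym b-q) (subst (Adj S q) (≡-sym c≡p) (adj-sym p-q))
                                      q≢d (λ q≡c → adj⇒≢ p-q (≡-sym (trans q≡c c≡p)))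
      choose (inj₂ (inj₁ c≡q)) = p , link-to (adj-sym b-p) (subst (Adj S p) (≡-sym c≡q) p-q)
                                      p≢d (λ p≡c → adj⇒≢ p-q (trans p≡c c≡q))
      choose (inj₂ (inj₂ c≡d)) = ⊥-elim (v≢c (≡-sym c≡d))

  -- The path R of g is disjoint from
  -- the path carrying g's triangle edge bc.  So g is not the centre of R (it
  -- would have four neighbours), and as an end g-b′-c′ of R it shares no
  -- neighbour z with b′ (the triangle g b′ z would be a second one at g).
  link-successor : ∀ {d g} → Link d g → ∃ (Link g)
  link-successor {d} {g} l = from-path (path-of g)
    where
    open Link l

    from-path : (∃ λ R → R ∈ paths × g ∈ V R) → ∃ (Link g)
    from-path (R , R∈ , g∈R) = from-position (position R g∈R)
      where
      disjoint : ∀ {w} → w ∈ V R → w ≡ b ⊎ w ≡ c → ⊥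
      disjoint w∈R w∈bc =
        g∉ (subst (λ P → g ∈ V P) (path-unique R∈ path∈ w∈R (edge⊆path w∈bc)) g∈R)

      from-position : EndOf g R ⊎ CentreOf g R → ∃ (Link g)
      from-position (inj₁ end′) = link-from-end R∈ end′ no-common
        where
        no-common : ∀ {z} → Adj S g z → Adj S (EndOf.b end′) z → ⊥
        no-common g-z b′-z = disjoint (EndOf.b∈ end′)
          (triangle-unique (EndOf.v-b end′) g-z b′-z g-b g-c b-c (inj₁ refl))
      from-position (inj₂ centre) =
        ⊥-elim (no-four-neighbours g-a₁ g-a₂ g-b g-c a₁≢a₂
                  (λ a₁≡b → disjoint a₁∈R (inj₁ a₁≡b)) (λ a₁≡c → disjoint a₁∈R (inj₂ a₁≡c))
                  (λ a₂≡b → disjoint a₂∈R (inj₁ a₂≡b)) (λ a₂≡c → disjoint a₂∈R (inj₂ a₂≡c))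
                  (adj⇒≢ b-c))
        where
        open CentreOf centre
          renaming (a to a₁; c to a₂; v-a to g-a₁; v-c to g-a₂; a≢c to a₁≢a₂; a∈ to a₁∈R; c∈ to a₂∈R)

  module Leaf {ℓ : Fin n} (leaf : degree S ℓ ≡ 1) where

    one-neighbour : ∀ {a b} → Adj S ℓ a → Adj S ℓ b → a ≢ b → ⊥
    one-neighbour ℓ-a ℓ-b a≢b with subst (2 ≤_) leaf (two-neighbours ℓ-a ℓ-b a≢b)
    ... | s≤s ()

    -- The target of a link has two neighbours, so it is not the leaf.
    no-predecessor : ∀ {d} → ¬ Link d ℓ
    no-predecessor l = one-neighbour (Link.g-b l) (Link.g-c l) (adj⇒≢ (Link.b-c l))

    -- The leaf is an end ℓ-b-c of its path and lies on no triangle.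
    has-successor : ∃ (Link ℓ)
    has-successor = from-path (path-of ℓ)
      where
      from-path : (∃ λ R → R ∈ paths × ℓ ∈ V R) → ∃ (Link ℓ)
      from-path (R , R∈ , ℓ∈R) with position R ℓ∈R
      ... | inj₁ end    = link-from-end R∈ end
                            (λ ℓ-z b-z → one-neighbour (EndOf.v-b end) ℓ-z (adj⇒≢ b-z))
      ... | inj₂ centre = ⊥-elim (one-neighbour (CentreOf.v-a centre) (CentreOf.v-c centre)
                                                (CentreOf.a≢c centre))

-- One vertex of degree 1 already rules out a Λ-factor: the leaf would
-- start an infinite chain of links.
leaf⇒no-ΛFactor : ∀ {n} (S : Graph n) →
  (∀ v → degree S v ≤ 3) →
  (∀ v → (degree S v ≡ 2) ⊎ (degree S v ≡ 3) → length (trianglesAt S v) ≡ 1) →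
  ∀ {ℓ} → degree S ℓ ≡ 1 → ¬ ΛFactor S
leaf⇒no-ΛFactor S max-degree one-triangle leaf F =
  noChainFromSource Link link-injective link-successor no-predecessor has-successor
  where
  open Links S max-degree one-triangle F
  open Leaf leaf

mainTheorem4 : (n : ℕ) (S : Graph n) → Connected S
    → (∀ v → degree S v ≤ 3)
    → (∀ v → (degree S v ≡ 2) ⊎ (degree S v ≡ 3) → length (trianglesAt S v) ≡ 1)
    → 3 ≤ length (filter (λ v → degree S v ≟ 1) (allFin n))
    → ¬ ΛFactor S
mainTheorem4 n S _ max-degree one-triangle three-leaves
  with count>0⇒witness _ (allFin n) (ℕP.≤-trans (s≤s z≤n) three-leaves)
... | ℓ , _ , leaf = leaf⇒no-ΛFactor S max-degree one-triangle leaf
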